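{- There exists an infinite op-square-free word over a $3$-letter totally ordered alphabet.
   Context: An order-preserving square is a word $uv$ with $|u|=|v|\ge 1$ and a strictly increasing bijection $f:\mathrm{Alph}(u)\to\mathrm{Alph}(v)$ ($\mathrm{Alph}$ = set of letters occurring) with $v[t]=f(u[t])$ for all $t$. A (finite or infinite) word is op-square-free if none of its finite factors is an order-preserving square of length greater than $2$. -}

module Defs where

open import Data.Nat using (ℕ; _+_; _*_; _<_; _>_)
open import Data.Fin using (Fin) renaming (_<_ to _<ᶠ_)
open import Data.Product using (Σ; _×_; ∃)
open import Relation.Binary.PropositionalEquality using (_≡_)
open import Relation.Nullary using (¬_)

Word : ℕ → ℕ → Set
Word k m = Fin m → Fin k

Occurs : ∀ {k m} → Fin k → Word k m → Set
Occurs a u = ∃ λ t → u t ≡ a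

-- Such f restricted to Alph(u) is then a strictly
-- increasing bijection Alph(u) → Alph(v) (surjective since v[t] = f(u[t]),
-- injective since strictly increasing), and conversely any such bijection
-- extends (arbitrarily) to a map on the whole alphabet.
IsOPSquare : ∀ {k n} → Word k n → Word k n → Set
IsOPSquare {k} {n} u v =
  Σ (Fin k → Fin k) λ f →
    ((a b : Fin k) → Occurs a u → Occurs b u → a <ᶠ b → f a <ᶠ f b)
    × ((t : Fin n) → v t ≡ f (u t))

InfWord : ℕ → Set
InfWord k = ℕ → Fin k

open import Data.Fin using (toℕ)

factor : ∀ {k} → InfWord k → (i m : ℕ) → Word k m
factor w i m t = w (i + toℕ t)

OPSquareFree : ∀ {k} → InfWord k → Set
OPSquareFree w = (i n : ℕ) → 2 * n > 2 →
  ¬ IsOPSquare (factor w i n) (factor w (i + n) n)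

-- Let z be the fixed point of the 2-uniform morphism σ : (a , b) ↦ (a , ¬a) (¬a , b) on the
-- four letters Bool × Bool, and w its image under the 2-uniform coding g into {0, 1, 2}.
-- Both z (over z) and w (over z) are recognizable images: three consecutive letters reveal the
-- parity of their position, and every letter of z can be read off from two consecutive letters
-- of the image, whichever parity the pair starts at. So a square of period n ≥ 3 in such an image
-- has even period and halves to a square of period n / 2 in z. Hence z is square-free as soon as
-- it has no squares of period 1 and 2, and w has no squares of period at least 3. Every factor of
-- w of length 6 contains all three letters, so an op-square of period at least 6 in w is an
-- ordinary square. Op-squares of period 2 to 5, the short squares of z and the local facts used
-- above concern windows of bounded length, each lying inside the image of a 2-letter factor of z;
-- there are six such factors, and the remaining finite check is done by evaluation.
module Submission where

open import Defs
open import Data.Bool as Bool using (Bool; true; false; not)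
open import Data.Bool.Properties using (not-involutive)
open import Data.Fin as Fin using (Fin; toℕ; fromℕ<) renaming (_<_ to _<ᶠ_)
open import Data.Fin.Properties using (any?; all?; toℕ<n; toℕ-fromℕ<) renaming (_≟_ to _≟ᶠ_; _<?_ to _<ᶠ?_)
open import Data.List using (List; []; _∷_)
open import Data.List.Membership.Propositional using (_∈_)
open import Data.List.Relation.Unary.Any using (here; there)
open import Data.List.Relation.Unary.All as All using (All; []; _∷_)
open import Data.Nat using (ℕ; zero; suc; _+_; _*_; _^_; _≤_; _<_; _<?_; z≤n; s≤s; z<s; NonZero; ⌊_/2⌋; ⌈_/2⌉; parity)
open import Data.Nat.Properties
open import Data.Nat.DivMod using (_/_; _%_; m≡m%n+[m/n]*n; m%n<n)
open import Data.Nat.Induction using (<-rec)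
open import Data.Nat.Tactic.RingSolver using (solve-∀)
open import Data.Parity.Base as ℙ using (Parity; 0ℙ; 1ℙ)
open import Data.Parity.Properties as ℙₚ using (+-homo-+; *-homo-*)
open import Data.Product using (∃; ∃₂; _×_; _,_; proj₁; proj₂)
open import Data.Product.Properties using (≡-dec)
open import Data.Sum using (_⊎_; inj₁; inj₂; [_,_])
open import Function using (_∘_)
open import Relation.Binary.Definitions using (DecidableEquality)
open import Relation.Binary.PropositionalEquality
  using (_≡_; _≢_; refl; sym; trans; cong; cong₂; subst; subst₂; module ≡-Reasoning)
open import Relation.Nullary using (¬_; Dec; yes; no)
open import Relation.Nullary.Decidable using (from-yes; map′; ¬?; _×-dec_; _⊎-dec_)

private variable
  A C D : Set

cong₃ : ∀ (f : A → A → A → D) {a b c a′ b′ c′} → a ≡ a′ → b ≡ b′ → c ≡ c′ → f a b c ≡ f a′ b′ c′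
cong₃ f refl refl refl = refl

⌊n+2*m/2⌋≡⌊n/2⌋+m : ∀ n m → ⌊ n + 2 * m /2⌋ ≡ ⌊ n /2⌋ + m
⌊n+2*m/2⌋≡⌊n/2⌋+m n zero = trans (cong ⌊_/2⌋ (+-identityʳ n)) (sym (+-identityʳ _))
⌊n+2*m/2⌋≡⌊n/2⌋+m n (suc m) = begin
  ⌊ n + 2 * suc m /2⌋   ≡⟨ cong ⌊_/2⌋ (n+2[1+m]≡2+[n+2m] n m) ⟩
  suc ⌊ n + 2 * m /2⌋   ≡⟨ cong suc (⌊n+2*m/2⌋≡⌊n/2⌋+m n m) ⟩
  suc (⌊ n /2⌋ + m)     ≡⟨ +-suc _ m ⟨
  ⌊ n /2⌋ + suc m       ∎
  where
  open ≡-Reasoning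
  n+2[1+m]≡2+[n+2m] : ∀ n m → n + 2 * suc m ≡ 2 + (n + 2 * m)
  n+2[1+m]≡2+[n+2m] = solve-∀

parity-n+2*m : ∀ n m → parity (n + 2 * m) ≡ parity n
parity-n+2*m n m = trans (+-homo-+ n (2 * m))
  (trans (cong (parity n ℙ.+_) (*-homo-* 2 m)) (ℙₚ.+-identityʳ (parity n)))

⌊n/2⌋<m : ∀ {n m} → n < 2 * m → ⌊ n /2⌋ < m
⌊n/2⌋<m {n} {m} n<2m = *-cancelˡ-< 2 ⌊ n /2⌋ m (≤-<-trans 2⌊n/2⌋≤n n<2m)
  where
  open ≤-Reasoning
  2⌊n/2⌋≤n : 2 * ⌊ n /2⌋ ≤ n
  2⌊n/2⌋≤n = begin
    2 * ⌊ n /2⌋         ≡⟨ cong (⌊ n /2⌋ +_) (+-identityʳ _) ⟩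
    ⌊ n /2⌋ + ⌊ n /2⌋   ≤⟨ +-monoʳ-≤ ⌊ n /2⌋ (⌊n/2⌋≤⌈n/2⌉ n) ⟩
    ⌊ n /2⌋ + ⌈ n /2⌉   ≡⟨ ⌊n/2⌋+⌈n/2⌉≡n n ⟩
    n                   ∎

r+2k<2p : ∀ {r k p} → r ≤ 1 → k < p → r + 2 * k < 2 * p
r+2k<2p {r} {k} {p} r≤1 k<p = begin-strict
  r + 2 * k   <⟨ +-monoˡ-< (2 * k) (s≤s r≤1) ⟩
  2 + 2 * k   ≡⟨ *-suc 2 k ⟨
  2 * suc k   ≤⟨ *-monoʳ-≤ 2 k<p ⟩
  2 * p       ∎
  where open ≤-Reasoning

3≤2p⇒0<p<2p : ∀ {p} → 3 ≤ 2 * p → 0 < p × p < 2 * p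
3≤2p⇒0<p<2p {suc p} _ = z<s , m<m+n (suc p) z<s

even-or-odd : ∀ n → (∃ λ a → n ≡ 2 * a) ⊎ (∃ λ a → n ≡ 1 + 2 * a)
even-or-odd zero = inj₁ (0 , refl)
even-or-odd (suc n) with even-or-odd n
... | inj₁ (a , refl) = inj₂ (a , refl)
... | inj₂ (a , refl) = inj₁ (suc a , 2+2a≡2[1+a] a)
  where
  2+2a≡2[1+a] : ∀ a → 2 + 2 * a ≡ 2 * suc a
  2+2a≡2[1+a] = solve-∀

parity≡0ℙ⇒even : ∀ n → parity n ≡ 0ℙ → ∃ λ a → n ≡ 2 * a
parity≡0ℙ⇒even n even with even-or-odd n
... | inj₁ n≡2a = n≡2a
... | inj₂ (a , refl) with () ← trans (sym (parity-n+2*m 1 a)) even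

shift : (ℕ → A) → ℕ → ℕ → A
shift u q m = u (m + q)

Agree : ℕ → (ℕ → A) → (ℕ → A) → Set
Agree n u v = ∀ {m} → m < n → u m ≡ v m

Agree-≤ : ∀ {n n′} {u v : ℕ → A} → n ≤ n′ → Agree n′ u v → Agree n u v
Agree-≤ n≤n′ u≈v m<n = u≈v (<-≤-trans m<n n≤n′)

StartsWithSquare : (ℕ → A) → ℕ → Set
StartsWithSquare u n = ∀ {k} → k < n → u k ≡ u (n + k)

SquareFree : (ℕ → A) → Set
SquareFree x = ∀ {p} → 0 < p → ∀ a → ¬ StartsWithSquare (shift x a) p

NoShortSquare : (ℕ → A) → Set
NoShortSquare u = ∀ {n} → n < 2 → ¬ StartsWithSquare u (suc n)

StartsWithSquare-agree : ∀ {L n} {u v : ℕ → A} → Agree L u v → 2 * n ≤ L →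
                         StartsWithSquare u n → StartsWithSquare v n
StartsWithSquare-agree {n = n} u≈v 2n≤L sq {k} k<n =
  trans (sym (u≈v (<-≤-trans k<n (≤-trans (m≤m+n n _) 2n≤L))))
        (trans (sq k<n) (u≈v (<-≤-trans n+k<2n 2n≤L)))
  where
  n+k<2n : n + k < 2 * n
  n+k<2n = subst (n + k <_) (cong (n +_) (sym (+-identityʳ n))) (+-monoʳ-< n k<n)

SyncsTo : (C → C → C → Parity) → Parity → (ℕ → C) → Set
SyncsTo sync p u = sync (u 0) (u 1) (u 2) ≡ p

SyncsTo-agree : ∀ (sync : C → C → C → Parity) {p L u v} → 3 ≤ L → Agree L u v →
                SyncsTo sync p u → SyncsTo sync p v
SyncsTo-agree sync 3≤L u≈v refl =
  sym (cong₃ sync (u≈v (≤-trans (s≤s z≤n) 3≤L)) (u≈v (≤-trans (s≤s (s≤s z≤n)) 3≤L)) (u≈v 3≤L))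

-- Unlike allUpTo? and anyUpTo?, these decide through ×-dec and ⊎-dec, which keeps the
-- proofs by evaluation (from-yes) below fast.
all<? : {P : ℕ → Set} → (∀ n → Dec (P n)) → ∀ v → Dec (∀ {n} → n < v → P n)
all<? P? zero    = yes λ ()
all<? {P} P? (suc v) = map′ extend (λ f → f ∘ m<n⇒m<1+n , f ≤-refl) (all<? P? v ×-dec P? v)
  where
  extend : (∀ {n} → n < v → P n) × P v → ∀ {n} → n < suc v → P n
  extend (below , at) {n} (s≤s n≤v) with m≤n⇒m<n∨m≡n n≤v
  ... | inj₁ n<v  = below n<v
  ... | inj₂ refl = at

any<? : {P : ℕ → Set} → (∀ n → Dec (P n)) → ∀ v → Dec (∃ λ n → n < v × P n)
any<? P? zero    = no λ ()
any<? {P} P? (suc v) = map′ [ widen , (λ at → v , ≤-refl , at) ] narrow (any<? P? v ⊎-dec P? v)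
  where
  widen : (∃ λ n → n < v × P n) → ∃ λ n → n < suc v × P n
  widen (n , n<v , pn) = n , m<n⇒m<1+n n<v , pn
  narrow : (∃ λ n → n < suc v × P n) → (∃ λ n → n < v × P n) ⊎ P v
  narrow (n , s≤s n≤v , pn) with m≤n⇒m<n∨m≡n n≤v
  ... | inj₁ n<v  = inj₁ (n , n<v , pn)
  ... | inj₂ refl = inj₂ pn

startsWithSquare? : DecidableEquality A → ∀ u n → Dec (StartsWithSquare u n)
startsWithSquare? _≟_ u n = all<? (λ k → u k ≟ u (n + k)) n

syncsTo? : ∀ (sync : C → C → C → Parity) p u → Dec (SyncsTo sync p u)
syncsTo? sync p u = sync (u 0) (u 1) (u 2) ℙₚ.≟ p

-- Recognizable 2-uniform images

record Recognizable (y : ℕ → C) (x : ℕ → A) : Set where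
  field
    sync            : C → C → C → Parity
    synchronizes    : ∀ i → sync (y i) (y (1 + i)) (y (2 + i)) ≡ parity i
    decode₀ decode₁ : C → C → A
    decodes₀        : ∀ m → decode₀ (y (2 * m)) (y (1 + 2 * m)) ≡ x m
    decodes₁        : ∀ m → decode₁ (y (1 + 2 * m)) (y (2 + 2 * m)) ≡ x m

square-period-even : ∀ {y : ℕ → C} (sync : C → C → C → Parity) →
  (∀ i → sync (y i) (y (1 + i)) (y (2 + i)) ≡ parity i) →
  ∀ {i n} → StartsWithSquare (shift y i) n → 3 ≤ n → ∃ λ p → n ≡ 2 * p
square-period-even {y = y} sync synchronizes {i} {n} sq 3≤n =
  parity≡0ℙ⇒even n (ℙₚ.+-cancelʳ-≡ (parity i) (parity n) 0ℙ (begin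
    parity n ℙ.+ parity i                              ≡⟨ +-homo-+ n i ⟨
    parity (n + i)                                     ≡⟨ synchronizes (n + i) ⟨
    sync (y (n + i)) (y (1 + n + i)) (y (2 + n + i))   ≡⟨ cong₃ sync (repeats z≤n) (repeats (s≤s z≤n)) (repeats (s≤s (s≤s z≤n))) ⟨
    sync (y i) (y (1 + i)) (y (2 + i))                 ≡⟨ synchronizes i ⟩
    parity i                                           ∎))
  where
  open ≡-Reasoning
  repeats : ∀ {k} → k ≤ 2 → y (k + i) ≡ y (k + n + i)
  repeats {k} k≤2 = trans (sq (<-≤-trans (s≤s k≤2) 3≤n)) (cong (λ j → y (j + i)) (+-comm n k))

decode-square : ∀ {y : ℕ → C} {x : ℕ → A} (decode : C → C → A) s →
  (∀ m → decode (y (s + 2 * m)) (y (1 + (s + 2 * m))) ≡ x m) →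
  ∀ {a p} → StartsWithSquare (shift y (s + 2 * a)) (2 * p) → StartsWithSquare (shift x a) p
decode-square {y = y} {x} decode s decodes {a} {p} sq {k} k<p = begin
  x (k + a)                                                          ≡⟨ decodes (k + a) ⟨
  decode (y (s + 2 * (k + a))) (y (1 + (s + 2 * (k + a))))           ≡⟨ cong₂ decode (repeats z≤n) (repeats (s≤s z≤n)) ⟩
  decode (y (s + 2 * (p + k + a))) (y (1 + (s + 2 * (p + k + a))))   ≡⟨ decodes (p + k + a) ⟩
  x (p + k + a)                                                      ∎
  where
  open ≡-Reasoning
  before : ∀ r s k a → r + (s + 2 * (k + a)) ≡ r + 2 * k + (s + 2 * a)
  before = solve-∀
  after : ∀ r s k a p → 2 * p + (r + 2 * k) + (s + 2 * a) ≡ r + (s + 2 * (p + k + a))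
  after = solve-∀
  repeats : ∀ {r} → r ≤ 1 → y (r + (s + 2 * (k + a))) ≡ y (r + (s + 2 * (p + k + a)))
  repeats {r} r≤1 = trans (cong y (before r s k a)) (trans (sq (r+2k<2p r≤1 k<p)) (cong y (after r s k a p)))

module _ {y : ℕ → C} {x : ℕ → A} (R : Recognizable y x) where
  open Recognizable R

  halve-square : ∀ {i n} → StartsWithSquare (shift y i) n → 3 ≤ n →
                 ∃₂ λ a p → n ≡ 2 * p × StartsWithSquare (shift x a) p
  halve-square {i} sq 3≤n with square-period-even {y = y} sync synchronizes sq 3≤n | even-or-odd i
  ... | p , refl | inj₁ (a , refl) = a , p , refl , decode-square {y = y} {x} decode₀ 0 decodes₀ sq
  ... | p , refl | inj₂ (a , refl) = a , p , refl , decode-square {y = y} {x} decode₁ 1 decodes₁ sq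

  squareFree⇒no-long-squares : SquareFree x → ∀ i {n} → 3 ≤ n → ¬ StartsWithSquare (shift y i) n
  squareFree⇒no-long-squares x-squareFree i 3≤n sq =
    let a , p , n≡2p , sq′ = halve-square sq 3≤n
    in x-squareFree (proj₁ (3≤2p⇒0<p<2p (subst (3 ≤_) n≡2p 3≤n))) a sq′

self-recognizable⇒squareFree : ∀ {y : ℕ → A} → Recognizable y y →
                               (∀ i → NoShortSquare (shift y i)) → SquareFree y
self-recognizable⇒squareFree {y = y} R no-short-square {p} = <-rec _ noSquare p
  where
  noSquare : ∀ p → (∀ {p′} → p′ < p → 0 < p′ → ∀ a → ¬ StartsWithSquare (shift y a) p′) →
             0 < p → ∀ a → ¬ StartsWithSquare (shift y a) p
  noSquare (suc n) shorter _ a sq with suc n <? 3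
  ... | yes (s≤s n<2) = no-short-square a n<2 sq
  ... | no 1+n≮3 =
    let b , p , 1+n≡2p , sq′ = halve-square R sq (≮⇒≥ 1+n≮3)
        0<p , p<2p = 3≤2p⇒0<p<2p (subst (3 ≤_) 1+n≡2p (≮⇒≥ 1+n≮3))
    in shorter (subst (p <_) (sym 1+n≡2p) p<2p) 0<p b sq′

-- 2-uniform morphisms and their fixed points

expand : (A → Parity → C) → (ℕ → A) → ℕ → C
expand h u n = h (u ⌊ n /2⌋) (parity n)

expand^ : (A → Parity → A) → ℕ → (ℕ → A) → ℕ → A
expand^ σ zero    u = u
expand^ σ (suc j) u = expand σ (expand^ σ j u)

shift-expand : ∀ (h : A → Parity → C) u q n → shift (expand h u) (2 * q) n ≡ expand h (shift u q) n
shift-expand h u q n = cong₂ h (cong u (⌊n+2*m/2⌋≡⌊n/2⌋+m n q)) (parity-n+2*m n q)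

expand-agree : ∀ (h : A → Parity → C) {b u v} → Agree b u v → Agree (2 * b) (expand h u) (expand h v)
expand-agree h u≈v {n} n<2b = cong (λ c → h c (parity n)) (u≈v (⌊n/2⌋<m n<2b))

expand^-agree : ∀ (σ : A → Parity → A) j {b u v} → Agree b u v →
                Agree (2 ^ j * b) (expand^ σ j u) (expand^ σ j v)
expand^-agree σ zero {b} u≈v = Agree-≤ (≤-reflexive (*-identityˡ b)) u≈v
expand^-agree σ (suc j) {b} u≈v =
  Agree-≤ (≤-reflexive (*-assoc 2 (2 ^ j) b)) (expand-agree σ (expand^-agree σ j u≈v))

IsFixedPoint : (A → Parity → A) → (ℕ → A) → Set
IsFixedPoint σ y = ∀ n → y n ≡ expand σ y n

fixedPoint-shift : ∀ {σ : A → Parity → A} {y} → IsFixedPoint σ y →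
                   ∀ j q n → shift y (2 ^ j * q) n ≡ expand^ σ j (shift y q) n
fixedPoint-shift {y = y} fixed zero q n = cong (λ m → y (n + m)) (*-identityˡ q)
fixedPoint-shift {σ = σ} {y} fixed (suc j) q n = begin
  y (n + 2 ^ suc j * q)                    ≡⟨ cong (λ m → y (n + m)) (*-assoc 2 (2 ^ j) q) ⟩
  y (n + 2 * (2 ^ j * q))                  ≡⟨ fixed _ ⟩
  shift (expand σ y) (2 * (2 ^ j * q)) n   ≡⟨ shift-expand σ y (2 ^ j * q) n ⟩
  expand σ (shift y (2 ^ j * q)) n         ≡⟨ cong (λ c → σ c (parity n)) (fixedPoint-shift fixed j q ⌊ n /2⌋) ⟩
  expand σ (expand^ σ j (shift y q)) n     ∎
  where open ≡-Reasoning

pair : A → A → ℕ → A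
pair c d zero    = c
pair c d (suc _) = d

fixedPoint-blocks : ∀ {σ : A → Parity → A} {y} → IsFixedPoint σ y →
  ∀ j q → Agree (2 ^ j * 2) (shift y (2 ^ j * q)) (expand^ σ j (pair (y q) (y (suc q))))
fixedPoint-blocks {σ = σ} {y} fixed j q {n} n<2^j*2 =
  trans (fixedPoint-shift fixed j q n) (expand^-agree σ j shift≈pair n<2^j*2)
  where
  shift≈pair : Agree 2 (shift y q) (pair (y q) (y (suc q)))
  shift≈pair {zero}        _ = refl
  shift≈pair {suc zero}    _ = refl
  shift≈pair {suc (suc _)} (s≤s (s≤s ()))

fixedPoint : (A → Parity → A) → A → ℕ → A
fixedPoint σ c n = expand^ σ n (λ _ → c) n

module _ (σ : A → Parity → A) {c : A} (prolongable : σ c 0ℙ ≡ c) where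

  expand^-step : ∀ j {n} → n ≤ j → expand^ σ (suc j) (λ _ → c) n ≡ expand^ σ j (λ _ → c) n
  expand^-step zero    z≤n = prolongable
  expand^-step (suc j) {n} n≤1+j = cong (λ a → σ a (parity n)) (expand^-step j (⌊n/2⌋≤j n n≤1+j))
    where
    ⌊n/2⌋≤j : ∀ n → n ≤ suc j → ⌊ n /2⌋ ≤ j
    ⌊n/2⌋≤j zero    _         = z≤n
    ⌊n/2⌋≤j (suc n) (s≤s n≤j) = ≤-trans (<⇒≤pred (⌊n/2⌋<n n)) n≤j

  expand^-stable : ∀ j {n} → n ≤ j → expand^ σ j (λ _ → c) n ≡ fixedPoint σ c n
  expand^-stable zero    z≤n = refl
  expand^-stable (suc j) n≤1+j with m≤n⇒m<n∨m≡n n≤1+j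
  ... | inj₁ (s≤s n≤j) = trans (expand^-step j n≤j) (expand^-stable j n≤j)
  ... | inj₂ refl      = refl

  fixedPoint-isFixedPoint : IsFixedPoint σ (fixedPoint σ c)
  fixedPoint-isFixedPoint zero    = sym prolongable
  fixedPoint-isFixedPoint (suc n) =
    cong (λ a → σ a (parity (suc n))) (expand^-stable n (<⇒≤pred (⌊n/2⌋<n n)))

-- Every window of y of length M + 1 lies inside a block Y c d for some pair (c , d) of pairs,
-- so a property of such windows holds everywhere once it holds on these finitely many blocks.
module Blocks {x : ℕ → A} {pairs : List (A × A)} (complete : ∀ q → (x q , x (suc q)) ∈ pairs)
              {y : ℕ → C} (M : ℕ) .{{_ : NonZero M}} (M-even : parity M ≡ 0ℙ)
              (Y : A → A → ℕ → C) (blocks : ∀ q → Agree (2 * M) (shift y (M * q)) (Y (x q) (x (suc q))))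
  where

  HoldsOnBlock : (Parity → (ℕ → C) → Set) → A × A → Set
  HoldsOnBlock P (c , d) = ∀ {k} → k < M → P (parity k) (shift (Y c d) k)

  holdsOnBlocks? : {P : Parity → (ℕ → C) → Set} → (∀ p u → Dec (P p u)) → Dec (All (HoldsOnBlock P) pairs)
  holdsOnBlocks? {P} P? = All.all? holdsOnBlock? pairs
    where
    holdsOnBlock? : ∀ cd → Dec (HoldsOnBlock P cd)
    holdsOnBlock? (c , d) = all<? (λ k → P? (parity k) (shift (Y c d) k)) M

  holds-everywhere : (P : Parity → (ℕ → C) → Set) → (∀ {p u v} → Agree (suc M) u v → P p u → P p v) →
                     All (HoldsOnBlock P) pairs → ∀ i → P (parity i) (shift y i)
  holds-everywhere P P-agree onBlocks i =
    subst (λ p → P p (shift y i)) same-parity (P-agree window≈ (All.lookup onBlocks (complete q) k<M))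
    where
    q k : ℕ
    q = i / M
    k = i % M
    k<M : k < M
    k<M = m%n<n i M
    i≡k+Mq : i ≡ k + M * q
    i≡k+Mq = trans (m≡m%n+[m/n]*n i M) (cong (k +_) (*-comm q M))
    same-parity : parity k ≡ parity i
    same-parity = sym (begin
      parity i                      ≡⟨ cong parity i≡k+Mq ⟩
      parity (k + M * q)            ≡⟨ +-homo-+ k (M * q) ⟩
      parity k ℙ.+ parity (M * q)   ≡⟨ cong (parity k ℙ.+_) (trans (*-homo-* M q) (cong (ℙ._* parity q) M-even)) ⟩
      parity k ℙ.+ 0ℙ               ≡⟨ ℙₚ.+-identityʳ (parity k) ⟩
      parity k                      ∎)
      where open ≡-Reasoning
    window≈ : Agree (suc M) (shift (Y (x q) (x (suc q))) k) (shift y i)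
    window≈ {m} m≤M = begin
      Y (x q) (x (suc q)) (m + k)   ≡⟨ blocks q m+k<2M ⟨
      y (m + k + M * q)             ≡⟨ cong y (+-assoc m k (M * q)) ⟩
      y (m + (k + M * q))           ≡⟨ cong (λ j → y (m + j)) i≡k+Mq ⟨
      y (m + i)                     ∎
      where
      open ≡-Reasoning
      m+k<2M : m + k < 2 * M
      m+k<2M = subst (m + k <_) (cong (M +_) (sym (+-identityʳ M))) (+-mono-≤-< (<⇒≤pred m≤M) k<M)

pattern 0F = Fin.zero
pattern 1F = Fin.suc Fin.zero
pattern 2F = Fin.suc (Fin.suc Fin.zero)

OrderMismatch : ∀ {k n} → Word k n → Word k n → Set
OrderMismatch u v = ∃₂ λ s t → (u s <ᶠ u t × ¬ v s <ᶠ v t) ⊎ (u s ≡ u t × v s ≢ v t)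

orderMismatch? : ∀ {k n} (u v : Word k n) → Dec (OrderMismatch u v)
orderMismatch? u v = any? λ s → any? λ t →
  (u s <ᶠ? u t ×-dec ¬? (v s <ᶠ? v t)) ⊎-dec (u s ≟ᶠ u t ×-dec ¬? (v s ≟ᶠ v t))

OrderMismatch-cong : ∀ {k n} {u u′ v v′ : Word k n} → (∀ t → u t ≡ u′ t) → (∀ t → v t ≡ v′ t) →
                     OrderMismatch u v → OrderMismatch u′ v′
OrderMismatch-cong u≗u′ v≗v′ (s , t , inj₁ (u<u , v≮v)) =
  s , t , inj₁ (subst₂ _<ᶠ_ (u≗u′ s) (u≗u′ t) u<u , v≮v ∘ subst₂ _<ᶠ_ (sym (v≗v′ s)) (sym (v≗v′ t)))
OrderMismatch-cong u≗u′ v≗v′ (s , t , inj₂ (u≡u , v≢v)) =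
  s , t , inj₂ (trans (sym (u≗u′ s)) (trans u≡u (u≗u′ t)) ,
                λ v′≡v′ → v≢v (trans (v≗v′ s) (trans v′≡v′ (sym (v≗v′ t)))))

OrderMismatch⇒¬IsOPSquare : ∀ {k n} {u v : Word k n} → OrderMismatch u v → ¬ IsOPSquare u v
OrderMismatch⇒¬IsOPSquare (s , t , inj₁ (u<u , v≮v)) (f , f-mono , v≡fu) =
  v≮v (subst₂ _<ᶠ_ (sym (v≡fu s)) (sym (v≡fu t)) (f-mono _ _ (s , refl) (t , refl) u<u))
OrderMismatch⇒¬IsOPSquare (s , t , inj₂ (u≡u , v≢v)) (f , _ , v≡fu) =
  v≢v (trans (v≡fu s) (trans (cong f u≡u) (sym (v≡fu t))))

OPMismatchAt : ∀ {k} → (ℕ → Fin k) → ℕ → Set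
OPMismatchAt u n = OrderMismatch (factor u 0 n) (factor u n n)

OPMismatchAt-agree : ∀ {k L n} {u v : ℕ → Fin k} → Agree L u v → 2 * n ≤ L → OPMismatchAt u n → OPMismatchAt v n
OPMismatchAt-agree {n = n} u≈v 2n≤L = OrderMismatch-cong
  (λ t → u≈v (<-≤-trans (toℕ<n t) (≤-trans (m≤m+n n _) 2n≤L)))
  (λ t → u≈v (<-≤-trans (subst (n + toℕ t <_) (cong (n +_) (sym (+-identityʳ n))) (+-monoʳ-< n (toℕ<n t))) 2n≤L))

increasing-Fin3 : ∀ {a b c : Fin 3} → a <ᶠ b → b <ᶠ c → a ≡ 0F × b ≡ 1F × c ≡ 2F
increasing-Fin3 {0F} {1F} {2F} _ _ = refl , refl , refl
increasing-Fin3 {_}  {0F}      () _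
increasing-Fin3 {_}  {_}  {0F} _  ()
increasing-Fin3 {1F} {1F}      (s≤s ()) _
increasing-Fin3 {2F} {1F}      (s≤s ()) _
increasing-Fin3 {_}  {1F} {1F} _ (s≤s ())
increasing-Fin3 {_}  {2F} {1F} _ (s≤s ())
increasing-Fin3 {_}  {2F} {2F} _ (s≤s (s≤s ()))

IsOPSquare-full-alphabet : ∀ {n} {u v : Word 3 n} → IsOPSquare u v → (∀ a → Occurs a u) → ∀ t → v t ≡ u t
IsOPSquare-full-alphabet {u = u} (f , f-mono , v≡fu) occurs t = trans (v≡fu t) (f-id (u t))
  where
  f-mono′ : ∀ {a b} → a <ᶠ b → f a <ᶠ f b
  f-mono′ {a} {b} = f-mono a b (occurs a) (occurs b)
  fixes : f 0F ≡ 0F × f 1F ≡ 1F × f 2F ≡ 2F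
  fixes = increasing-Fin3 (f-mono′ {0F} {1F} (s≤s z≤n)) (f-mono′ {1F} {2F} (s≤s (s≤s z≤n)))
  f-id : ∀ a → f a ≡ a
  f-id 0F = proj₁ fixes
  f-id 1F = proj₁ (proj₂ fixes)
  f-id 2F = proj₂ (proj₂ fixes)

AllLettersBefore : ∀ {k} → ℕ → (ℕ → Fin k) → Set
AllLettersBefore {k} L u = ∀ (a : Fin k) → ∃ λ m → m < L × u m ≡ a

AllLettersBefore-agree : ∀ {k L L′} {u v : ℕ → Fin k} → L ≤ L′ → Agree L′ u v →
                         AllLettersBefore L u → AllLettersBefore L v
AllLettersBefore-agree L≤L′ u≈v all a =
  let m , m<L , um≡a = all a in m , m<L , trans (sym (u≈v (<-≤-trans m<L L≤L′))) um≡a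

-- The square-free word z

Letter : Set
Letter = Bool × Bool

_≟ᴸ_ : DecidableEquality Letter
_≟ᴸ_ = ≡-dec Bool._≟_ Bool._≟_

σ : Letter → Parity → Letter
σ (a , b) 0ℙ = a , not a
σ (a , b) 1ℙ = not a , b

z : ℕ → Letter
z = fixedPoint σ (false , true)

z-fixed : IsFixedPoint σ z
z-fixed = fixedPoint-isFixedPoint σ refl

z-expand : ∀ m r → z (r + 2 * m) ≡ expand σ (shift z m) r
z-expand m r = trans (z-fixed (r + 2 * m)) (shift-expand σ z m r)

adjacentPairs : List (Letter × Letter)
adjacentPairs =
  ((false , true) , (true , false)) ∷ ((false , true) , (true , true)) ∷
  ((true , false) , (false , false)) ∷ ((true , false) , (false , true)) ∷
  ((false , false) , (false , true)) ∷ ((true , true) , (true , false)) ∷ []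

σ-within-adjacent : ∀ c → (σ c 0ℙ , σ c 1ℙ) ∈ adjacentPairs
σ-within-adjacent (false , false) = here refl
σ-within-adjacent (false , true)  = there (here refl)
σ-within-adjacent (true , false)  = there (there (here refl))
σ-within-adjacent (true , true)   = there (there (there (here refl)))

AcrossAdjacent : Letter × Letter → Set
AcrossAdjacent (c , d) = (σ c 1ℙ , σ d 0ℙ) ∈ adjacentPairs

σ-across-adjacent : All AcrossAdjacent adjacentPairs
σ-across-adjacent = from-yes (All.all? acrossAdjacent? adjacentPairs)
  where
  open import Data.List.Membership.DecPropositional (≡-dec _≟ᴸ_ _≟ᴸ_) using (_∈?_)
  acrossAdjacent? : ∀ cd → Dec (AcrossAdjacent cd)
  acrossAdjacent? (c , d) = (σ c 1ℙ , σ d 0ℙ) ∈? adjacentPairs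

z-adjacent : ∀ q → (z q , z (suc q)) ∈ adjacentPairs
z-adjacent = <-rec _ adjacent
  where
  adjacent : ∀ q → (∀ {m} → m < q → (z m , z (suc m)) ∈ adjacentPairs) → (z q , z (suc q)) ∈ adjacentPairs
  adjacent q earlier with even-or-odd q
  ... | inj₁ (m , refl) =
    subst₂ (λ c d → (c , d) ∈ adjacentPairs) (sym (z-expand m 0)) (sym (z-expand m 1)) (σ-within-adjacent (z m))
  ... | inj₂ (m , refl) =
    subst₂ (λ c d → (c , d) ∈ adjacentPairs) (sym (z-expand m 1)) (sym (z-expand m 2))
      (All.lookup σ-across-adjacent (earlier (s≤s (m≤m+n m _))))

module Z = Blocks z-adjacent {y = z} 4 refl (λ c d → expand^ σ 2 (pair c d)) (fixedPoint-blocks {σ = σ} z-fixed 2)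

-- Letters 00 and 11 occur only at odd positions, since σ c 0ℙ is 01 or 10.
zSync : Letter → Letter → Letter → Parity
zSync (false , false) _ _ = 1ℙ
zSync (true , true)   _ _ = 1ℙ
zSync (true , false) (false , true) (true , true)   = 1ℙ
zSync (false , true) (true , false) (false , false) = 1ℙ
zSync _ _ _ = 0ℙ

z-synchronizes : ∀ i → zSync (z i) (z (1 + i)) (z (2 + i)) ≡ parity i
z-synchronizes = Z.holds-everywhere (SyncsTo zSync) (SyncsTo-agree zSync (s≤s (s≤s (s≤s z≤n))))
  (from-yes (Z.holdsOnBlocks? (syncsTo? zSync)))

z-no-short-squares : ∀ i → NoShortSquare (shift z i)
z-no-short-squares = Z.holds-everywhere (λ _ → NoShortSquare)
  (λ u≈v noSq n<2 sq → noSq n<2 (StartsWithSquare-agree (sym ∘ u≈v) (≤-trans (*-monoʳ-≤ 2 n<2) (n≤1+n 4)) sq))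
  (from-yes (Z.holdsOnBlocks? λ _ u → all<? (λ n → ¬? (startsWithSquare? _≟ᴸ_ u (suc n))) 2))

unflip : Letter → Letter
unflip (a , b) = not a , b

unflip-σ : ∀ c → unflip (σ c 1ℙ) ≡ c
unflip-σ (a , b) = cong (_, b) (not-involutive a)

z-recognizable : Recognizable z z
z-recognizable = record
  { sync         = zSync
  ; synchronizes = z-synchronizes
  ; decode₀      = λ _ d → unflip d
  ; decode₁      = λ c _ → unflip c
  ; decodes₀     = λ m → trans (cong unflip (z-expand m 1)) (unflip-σ (z m))
  ; decodes₁     = λ m → trans (cong unflip (z-expand m 1)) (unflip-σ (z m))
  }

z-squareFree : SquareFree z
z-squareFree = self-recognizable⇒squareFree z-recognizable z-no-short-squares

-- The op-square-free word w

g : Letter → Parity → Fin 3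
g (false , false) _  = 0F
g (false , true)  0ℙ = 0F
g (false , true)  1ℙ = 1F
g (true , false)  0ℙ = 2F
g (true , false)  1ℙ = 1F
g (true , true)   _  = 2F

w : InfWord 3
w = expand g z

w-expand : ∀ m r → w (r + 2 * m) ≡ expand g (shift z m) r
w-expand = shift-expand g z

decodeWithin : Fin 3 → Fin 3 → Letter
decodeWithin 0F 0F = false , false
decodeWithin 0F _  = false , true
decodeWithin _  1F = true , false
decodeWithin _  _  = true , true

decodeWithin-g : ∀ c → decodeWithin (g c 0ℙ) (g c 1ℙ) ≡ c
decodeWithin-g (false , false) = refl
decodeWithin-g (false , true)  = refl
decodeWithin-g (true , false)  = refl
decodeWithin-g (true , true)   = refl

decodeAcross : Fin 3 → Fin 3 → Letter
decodeAcross 0F _  = false , false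
decodeAcross 1F 0F = true , false
decodeAcross 1F _  = false , true
decodeAcross 2F _  = true , true

DecodesAcross : Letter × Letter → Set
DecodesAcross (c , d) = decodeAcross (g c 1ℙ) (g d 0ℙ) ≡ c

decodeAcross-adjacent : All DecodesAcross adjacentPairs
decodeAcross-adjacent = refl ∷ refl ∷ refl ∷ refl ∷ refl ∷ refl ∷ []

w-blocks : ∀ q → Agree (2 * 16) (shift w (16 * q)) (expand g (expand^ σ 3 (pair (z q) (z (suc q)))))
w-blocks q {m} m<32 = begin
  w (m + 16 * q)                                      ≡⟨ cong (λ n → w (m + n)) (*-assoc 2 8 q) ⟩
  w (m + 2 * (8 * q))                                 ≡⟨ w-expand (8 * q) m ⟩
  expand g (shift z (8 * q)) m                        ≡⟨ expand-agree g (fixedPoint-blocks {σ = σ} z-fixed 3 q) m<32 ⟩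
  expand g (expand^ σ 3 (pair (z q) (z (suc q)))) m   ∎
  where open ≡-Reasoning

module W = Blocks z-adjacent {y = w} 16 refl (λ c d → expand g (expand^ σ 3 (pair c d))) w-blocks

-- Letter 1 occurs only at odd positions, since g c 0ℙ is 0 or 2.
wSync : Fin 3 → Fin 3 → Fin 3 → Parity
wSync 1F _  _  = 1ℙ
wSync 0F 0F 1F = 1ℙ
wSync 2F 2F 1F = 1ℙ
wSync _  _  _  = 0ℙ

w-synchronizes : ∀ i → wSync (w i) (w (1 + i)) (w (2 + i)) ≡ parity i
w-synchronizes = W.holds-everywhere (SyncsTo wSync) (SyncsTo-agree wSync (s≤s (s≤s (s≤s z≤n))))
  (from-yes (W.holdsOnBlocks? (syncsTo? wSync)))

w-recognizable : Recognizable w z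
w-recognizable = record
  { sync         = wSync
  ; synchronizes = w-synchronizes
  ; decode₀      = decodeWithin
  ; decode₁      = decodeAcross
  ; decodes₀     = λ m → trans (cong₂ decodeWithin (w-expand m 0) (w-expand m 1)) (decodeWithin-g (z m))
  ; decodes₁     = λ m → trans (cong₂ decodeAcross (w-expand m 1) (w-expand m 2))
                                 (All.lookup decodeAcross-adjacent (z-adjacent m))
  }

w-letters : ∀ i → AllLettersBefore 6 (shift w i)
w-letters = W.holds-everywhere (λ _ → AllLettersBefore 6) (AllLettersBefore-agree (m≤m+n 6 11))
  (from-yes (W.holdsOnBlocks? λ _ u → all? λ a → any<? (λ m → u m ≟ᶠ a) 6))

w-short-op-mismatch : ∀ i {n} → n < 4 → OPMismatchAt (shift w i) (2 + n)
w-short-op-mismatch = W.holds-everywhere (λ _ u → ∀ {n} → n < 4 → OPMismatchAt u (2 + n))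
  (λ u≈v mismatch n<4 →
    OPMismatchAt-agree u≈v (≤-trans (*-monoʳ-≤ 2 (s≤s (s≤s (<⇒≤pred n<4)))) (m≤m+n 10 7)) (mismatch n<4))
  (from-yes (W.holdsOnBlocks? λ _ u → all<? (λ n → orderMismatch? (factor u 0 (2 + n)) (factor u (2 + n) (2 + n))) 4))

w-no-short-op-squares : ∀ i {n} → 2 ≤ n → n < 6 → ¬ IsOPSquare (factor w i n) (factor w (i + n) n)
w-no-short-op-squares i {suc (suc n)} (s≤s (s≤s z≤n)) (s≤s (s≤s n<4)) =
  OrderMismatch⇒¬IsOPSquare
    (OrderMismatch-cong (λ t → cong w (+-comm (toℕ t) i)) (λ t → cong w (moved (toℕ t))) (w-short-op-mismatch i n<4))
  where
  moved : ∀ t → 2 + n + t + i ≡ i + (2 + n) + t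
  moved t = trans (+-comm (2 + n + t) i) (sym (+-assoc i (2 + n) t))

w-no-long-op-squares : ∀ i {n} → 6 ≤ n → ¬ IsOPSquare (factor w i n) (factor w (i + n) n)
w-no-long-op-squares i {n} 6≤n op =
  squareFree⇒no-long-squares w-recognizable z-squareFree i (≤-trans (m≤m+n 3 3) 6≤n) square
  where
  occurs : ∀ a → Occurs a (factor w i n)
  occurs a = let m , m<6 , w[m+i]≡a = w-letters i a in
    fromℕ< (<-≤-trans m<6 6≤n) ,
    trans (cong (λ j → w (i + j)) (toℕ-fromℕ< _)) (trans (cong w (+-comm i m)) w[m+i]≡a)
  square : StartsWithSquare (shift w i) n
  square {k} k<n = begin
    w (k + i)                         ≡⟨ cong w (+-comm k i) ⟩
    w (i + k)                         ≡⟨ cong (λ j → w (i + j)) (toℕ-fromℕ< k<n) ⟨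
    factor w i n (fromℕ< k<n)         ≡⟨ IsOPSquare-full-alphabet op occurs (fromℕ< k<n) ⟨
    factor w (i + n) n (fromℕ< k<n)   ≡⟨ cong (λ j → w (i + n + j)) (toℕ-fromℕ< k<n) ⟩
    w (i + n + k)                     ≡⟨ cong w (i+n+k≡n+k+i i n k) ⟩
    w (n + k + i)                     ∎
    where
    open ≡-Reasoning
    i+n+k≡n+k+i : ∀ i n k → i + n + k ≡ n + k + i
    i+n+k≡n+k+i = solve-∀

theorem31 : ∃ λ (w : InfWord 3) → OPSquareFree w
theorem31 = w , op-square-free
  where
  op-square-free : OPSquareFree w
  op-square-free i n 2n>2 with n <? 6
  ... | yes n<6 = w-no-short-op-squares i (*-cancelˡ-< 2 1 n 2n>2) n<6
  ... | no n≮6  = w-no-long-op-squares i (≮⇒≥ n≮6)
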